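{- Let $q$ be a prime power, $n\ge1$, $f:\mathbb{F}_{q^n}\to\mathbb{F}_q$, let $\gamma\in\mathbb{F}_{q^n}$ be a $b$-linear translator of $f$, and let $F(x)=x+\gamma f(x)$. For $k\ge1$ let $F_k$ denote the $k$-fold composition $F\circ\cdots\circ F$. Then for every $k\ge1$ and all $x\in\mathbb{F}_{q^n}$, $$F_k(x)=x+B_k\,\gamma\,f(x),\quad\text{where } B_k=1+(b+1)+\dots+(b+1)^{k-1}=\begin{cases}k & \text{if } b=0,\\ \frac{(b+1)^k-1}{b} & \text{if } b\neq0.\end{cases}$$
   Context: A non-zero $\gamma\in\mathbb{F}_{q^n}$ is a $b$-linear translator ($b\in\mathbb{F}_q$) of $f:\mathbb{F}_{q^n}\to\mathbb{F}_q$ if $f(x+u\gamma)-f(x)=ub$ for all $x\in\mathbb{F}_{q^n}$, $u\in\mathbb{F}_q$. Here $k$ in the case $b=0$ is interpreted as an element of the prime field. -}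

module Defs where

open import Level using (Level; _⊔_)
open import Data.Nat using (ℕ; zero; suc; _≥_)
import Data.Nat as ℕ
open import Data.Nat.Primality using (Prime)
open import Data.Fin using (Fin)
open import Data.Product using (∃; ∃-syntax; _×_)
open import Relation.Nullary using (¬_)
open import Relation.Binary.PropositionalEquality using (_≡_)
import Relation.Binary.PropositionalEquality as ≡
open import Function.Bundles using (Inverse)
open import Algebra.Bundles using (CommutativeRing)
open import Algebra.Bundles.Raw using (RawRing)
open import Algebra.Morphism.Structures using (module RingMorphisms)
import Algebra.Definitions.RawSemiring as RawSemiringDefs

IsPrimePower : ℕ → Set
IsPrimePower q = ∃[ p ] ∃[ m ] (Prime p × m ≥ 1 × q ≡ p ℕ.^ m)

record IsFiniteField {c ℓ} (R : CommutativeRing c ℓ) (q : ℕ) : Set (c ⊔ ℓ) where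
  open CommutativeRing R
  field
    nontrivial : ¬ (1# ≈ 0#)
    inverse    : ∀ x → ¬ (x ≈ 0#) → ∃[ y ] (x * y ≈ 1#)
    card       : Inverse setoid (≡.setoid (Fin q))

IsEmbedding : ∀ {c₁ ℓ₁ c₂ ℓ₂} (K : CommutativeRing c₁ ℓ₁) (L : CommutativeRing c₂ ℓ₂) →
              (CommutativeRing.Carrier K → CommutativeRing.Carrier L) → Set (c₁ ⊔ ℓ₁ ⊔ ℓ₂)
IsEmbedding K L ι =
  RingMorphisms.IsRingHomomorphism (CommutativeRing.rawRing K) (CommutativeRing.rawRing L) ι

IsLinearTranslator : ∀ {c₁ ℓ₁ c₂ ℓ₂} (K : CommutativeRing c₁ ℓ₁) (L : CommutativeRing c₂ ℓ₂) →
  (ι : CommutativeRing.Carrier K → CommutativeRing.Carrier L) →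
  (f : CommutativeRing.Carrier L → CommutativeRing.Carrier K) →
  (γ : CommutativeRing.Carrier L) → (b : CommutativeRing.Carrier K) → Set (c₁ ⊔ ℓ₁ ⊔ c₂ ⊔ ℓ₂)
IsLinearTranslator K L ι f γ b =
  ¬ (γ L.≈ L.0#) × (∀ x u → f (x L.+ ι u L.* γ) K.- f x K.≈ u K.* b)
  where
    module K = CommutativeRing K
    module L = CommutativeRing L

iterate : ∀ {a} {A : Set a} → (A → A) → ℕ → A → A
iterate F zero    x = x
iterate F (suc k) x = F (iterate F k x)

module _ {c ℓ} (K : CommutativeRing c ℓ) where
  open CommutativeRing K
  open RawSemiringDefs (RawRing.rawSemiring rawRing) using (_^_) renaming (_×_ to _·ℕ_)

  geomSum : Carrier → ℕ → Carrier
  geomSum b zero    = 0#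
  geomSum b (suc k) = geomSum b k + (b + 1#) ^ k

  pow : Carrier → ℕ → Carrier
  pow = _^_

  natMul : ℕ → Carrier → Carrier
  natMul = _·ℕ_

module Submission where

-- * Geometric sums (module GeometricSum, any commutative ring K): the
--   telescoping identity 1 + B_k b = (b+1)^k, from which B_k = k when b = 0
--   and B_k = ((b+1)^k - 1) b⁻¹ when b is invertible.
--
-- * Iteration (module Iteration, any commutative rings K, L with a ring
--   homomorphism ι : K → L): the translator property says that moving x by
--   ι(u) γ changes f by u b.  Hence if y = x + B γ f(x) then
--   f(y) = (1 + B b) f(x); with B = B_k this is (b+1)^k f(x) by telescoping,
--   so F_{k+1}(x) = F_k(x) + γ f(F_k(x)) = x + (B_k + (b+1)^k) γ f(x), which is
--   the closed form for k+1 because B_{k+1} = B_k + (b+1)^k.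
--
-- Finiteness of K and L plays no role, and in the case b ≠ 0 only the given
-- inverse b⁻¹ is used: the theorem holds over arbitrary commutative rings.

open import Defs
open import Level using (Level)
open import Data.Nat using (ℕ; _≥_; zero; suc)
open import Data.Product using (_×_; _,_)
open import Relation.Nullary using (¬_)
open import Algebra.Bundles using (CommutativeRing)
open import Algebra.Morphism.Structures using (module RingMorphisms)
import Algebra.Properties.AbelianGroup as AbelianGroupProperties
import Algebra.Properties.Semiring.Exp as SemiringExp
import Algebra.Solver.Ring.NaturalCoefficients.Default as SemiringSolver
import Relation.Binary.Reasoning.Setoid as SetoidReasoning

module GeometricSum {c ℓ} (K : CommutativeRing c ℓ) where
  open CommutativeRing K
  open SetoidReasoning setoid
  open SemiringSolver commutativeSemiring
  open AbelianGroupProperties +-abelianGroup using (xyx⁻¹≈y)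
  open SemiringExp semiring using (^-congˡ)

  geomSum-telescopes : ∀ b k → 1# + geomSum K b k * b ≈ pow K (b + 1#) k
  geomSum-telescopes b zero =
    solve 1 (λ b → con 1 :+ con 0 :* b := con 1) refl b
  geomSum-telescopes b (suc k) = begin
    1# + (B + P) * b    ≈⟨ solve 3 (λ B P b → con 1 :+ (B :+ P) :* b
                                            := (con 1 :+ B :* b) :+ P :* b) refl B P b ⟩
    (1# + B * b) + P * b ≈⟨ +-cong (geomSum-telescopes b k) refl ⟩
    P + P * b           ≈⟨ solve 2 (λ P b → P :+ P :* b := (b :+ con 1) :* P) refl P b ⟩
    (b + 1#) * P        ∎
    where
    B P : Carrier
    B = geomSum K b k
    P = pow K (b + 1#) k

  geomSum-telescopes-on : ∀ b k y → (geomSum K b k * y) * b + y ≈ pow K (b + 1#) k * y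
  geomSum-telescopes-on b k y = begin
    (B * y) * b + y     ≈⟨ solve 3 (λ B y b → (B :* y) :* b :+ y := (con 1 :+ B :* b) :* y)
                                 refl B y b ⟩
    (1# + B * b) * y    ≈⟨ *-cong (geomSum-telescopes b k) refl ⟩
    pow K (b + 1#) k * y ∎
    where
    B : Carrier
    B = geomSum K b k

  pow-one : ∀ k → pow K 1# k ≈ 1#
  pow-one zero    = refl
  pow-one (suc k) = trans (*-cong refl (pow-one k)) (*-identityˡ 1#)

  -- For b = 0 every summand (b+1)^i is 1, so B_k = k.
  geomSum-at-zero : ∀ b k → b ≈ 0# → geomSum K b k ≈ natMul K k 1#
  geomSum-at-zero b zero    b≈0 = refl
  geomSum-at-zero b (suc k) b≈0 = begin
    geomSum K b k + pow K (b + 1#) k ≈⟨ +-cong (geomSum-at-zero b k b≈0) summand≈1 ⟩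
    natMul K k 1# + 1#               ≈⟨ +-comm _ 1# ⟩
    1# + natMul K k 1#               ∎
    where
    summand≈1 : pow K (b + 1#) k ≈ 1#
    summand≈1 = trans (^-congˡ k (trans (+-cong b≈0 refl) (+-identityˡ 1#))) (pow-one k)

  -- For invertible b, dividing the telescoping identity by b.
  geomSum-by-inverse : ∀ b k b⁻¹ → b * b⁻¹ ≈ 1# →
                       geomSum K b k ≈ (pow K (b + 1#) k - 1#) * b⁻¹
  geomSum-by-inverse b k b⁻¹ bb⁻¹≈1 = begin
    B                          ≈⟨ *-identityʳ B ⟨
    B * 1#                     ≈⟨ *-cong refl bb⁻¹≈1 ⟨
    B * (b * b⁻¹)              ≈⟨ *-assoc B b b⁻¹ ⟨
    (B * b) * b⁻¹              ≈⟨ *-cong (xyx⁻¹≈y 1# (B * b)) refl ⟨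
    (1# + B * b - 1#) * b⁻¹    ≈⟨ *-cong (+-cong (geomSum-telescopes b k) refl) refl ⟩
    (pow K (b + 1#) k - 1#) * b⁻¹ ∎
    where
    B : Carrier
    B = geomSum K b k

module Iteration
  {c₁ ℓ₁ c₂ ℓ₂} (K : CommutativeRing c₁ ℓ₁) (L : CommutativeRing c₂ ℓ₂)
  (ι : CommutativeRing.Carrier K → CommutativeRing.Carrier L) (ι-hom : IsEmbedding K L ι)
  (f : CommutativeRing.Carrier L → CommutativeRing.Carrier K)
  (f-cong : ∀ {x y} → CommutativeRing._≈_ L x y → CommutativeRing._≈_ K (f x) (f y))
  (γ : CommutativeRing.Carrier L) (b : CommutativeRing.Carrier K)
  (translates : ∀ x u → CommutativeRing._≈_ K
                  (CommutativeRing._-_ K (f (CommutativeRing._+_ L x (CommutativeRing._*_ L (ι u) γ))) (f x))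
                  (CommutativeRing._*_ K u b))
  where
  module K = CommutativeRing K
  open CommutativeRing L
  open SetoidReasoning setoid
  open SemiringSolver commutativeSemiring
  open RingMorphisms.IsRingHomomorphism ι-hom using (⟦⟧-cong; +-homo; *-homo; 0#-homo)
  open GeometricSum K using (geomSum-telescopes-on)

  F : Carrier → Carrier
  F y = y + γ * ι (f y)

  translator-shift : ∀ x u → f (x + ι u * γ) K.≈ u K.* b K.+ f x
  translator-shift x u = K.trans (K.sym (//-rightDividesˡ (f x) (f (x + ι u * γ))))
                                 (K.+-cong (translates x u) K.refl)
    where open AbelianGroupProperties K.+-abelianGroup using (//-rightDividesˡ)

  f-after-shift : ∀ x B → f (x + (ι B * γ) * ι (f x)) K.≈ (B K.* f x) K.* b K.+ f x
  f-after-shift x B = K.trans (f-cong shift-as-translate) (translator-shift x (B K.* f x))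
    where
    shift-as-translate : x + (ι B * γ) * ι (f x) ≈ x + ι (B K.* f x) * γ
    shift-as-translate = begin
      x + (ι B * γ) * ι (f x)      ≈⟨ solve 4 (λ x β γ a → x :+ (β :* γ) :* a := x :+ (β :* a) :* γ)
                                            refl x (ι B) γ (ι (f x)) ⟩
      x + (ι B * ι (f x)) * γ      ≈⟨ +-cong refl (*-cong (*-homo B (f x)) refl) ⟨
      x + ι (B K.* f x) * γ        ∎

  iterate-closed-form : ∀ k x → iterate F k x ≈ x + (ι (geomSum K b k) * γ) * ι (f x)
  iterate-closed-form zero x = begin
    x                            ≈⟨ solve 3 (λ x γ a → x := x :+ (con 0 :* γ) :* a) refl x γ (ι (f x)) ⟩
    x + (0# * γ) * ι (f x)       ≈⟨ +-cong refl (*-cong (*-cong 0#-homo refl) refl) ⟨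
    x + (ι K.0# * γ) * ι (f x)   ∎
  iterate-closed-form (suc k) x = begin
    Fₖx + γ * ι (f Fₖx)                  ≈⟨ +-cong closed-form (*-cong refl (⟦⟧-cong f-at-Fₖx)) ⟩
    (x + (β * γ) * a) + γ * ι (P K.* f x) ≈⟨ +-cong refl (*-cong refl (*-homo P (f x))) ⟩
    (x + (β * γ) * a) + γ * (ι P * a)    ≈⟨ solve 5 (λ x β π γ a → (x :+ (β :* γ) :* a) :+ γ :* (π :* a)
                                                  := x :+ ((β :+ π) :* γ) :* a) refl x β (ι P) γ a ⟩
    x + ((β + ι P) * γ) * a              ≈⟨ +-cong refl (*-cong (*-cong (+-homo B P) refl) refl) ⟨
    x + (ι (B K.+ P) * γ) * a            ∎
    where
    B P : K.Carrier
    B = geomSum K b k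
    P = pow K (b K.+ K.1#) k
    Fₖx β a : Carrier
    Fₖx = iterate F k x
    β = ι B
    a = ι (f x)
    closed-form : Fₖx ≈ x + (β * γ) * a
    closed-form = iterate-closed-form k x
    f-at-Fₖx : f Fₖx K.≈ P K.* f x
    f-at-Fₖx = K.trans (f-cong closed-form)
                 (K.trans (f-after-shift x B) (geomSum-telescopes-on b k (f x)))

mainTheorem6 : ∀ {c₁ ℓ₁ c₂ ℓ₂ : Level}
    (q n : ℕ) → IsPrimePower q → n ≥ 1 →
    (K : CommutativeRing c₁ ℓ₁) → IsFiniteField K q →
    (L : CommutativeRing c₂ ℓ₂) → IsFiniteField L (q Data.Nat.^ n) →
    (ι : CommutativeRing.Carrier K → CommutativeRing.Carrier L) → IsEmbedding K L ι →
    (f : CommutativeRing.Carrier L → CommutativeRing.Carrier K) →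
    (∀ {x y} → CommutativeRing._≈_ L x y → CommutativeRing._≈_ K (f x) (f y)) →
    (γ : CommutativeRing.Carrier L) (b : CommutativeRing.Carrier K) →
    IsLinearTranslator K L ι f γ b →
    ∀ (k : ℕ) → k ≥ 1 →
      (∀ x → CommutativeRing._≈_ L
          (iterate (λ y → CommutativeRing._+_ L y (CommutativeRing._*_ L γ (ι (f y)))) k x)
          (CommutativeRing._+_ L x
            (CommutativeRing._*_ L (CommutativeRing._*_ L (ι (geomSum K b k)) γ) (ι (f x)))))
      × (CommutativeRing._≈_ K b (CommutativeRing.0# K) →
          CommutativeRing._≈_ K (geomSum K b k) (natMul K k (CommutativeRing.1# K)))
      × (¬ CommutativeRing._≈_ K b (CommutativeRing.0# K) →
          ∀ b⁻¹ → CommutativeRing._≈_ K (CommutativeRing._*_ K b b⁻¹) (CommutativeRing.1# K) →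
          CommutativeRing._≈_ K (geomSum K b k)
            (CommutativeRing._*_ K
              (CommutativeRing._-_ K (pow K (CommutativeRing._+_ K b (CommutativeRing.1# K)) k)
                (CommutativeRing.1# K))
              b⁻¹))
mainTheorem6 _ _ _ _ K _ L _ ι ι-hom f f-cong γ b (_ , translates) k _ =
    Iteration.iterate-closed-form K L ι ι-hom f f-cong γ b translates k
  , GeometricSum.geomSum-at-zero K b k
  , λ _ → GeometricSum.geomSum-by-inverse K b k
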